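{- For any matroid $M$ (not necessarily realizable) on $E=\{0,\dots,n\}$, the two tuples of Laurent polynomials indexed by permutations $\sigma$ of $E$, \[ [\mathcal S_M]_\sigma=\sum_{i\in B_\sigma(M)}T_i^{ -1},\qquad [\mathcal Q_M]_\sigma=\sum_{i\notin B_\sigma(M)}T_i^{ -1}, \] define well-defined elements of $K^0_T(X_E)$, and they satisfy $[\mathcal S_M]+[\mathcal Q_M]=[X_E\times\mathbb C^E_{\mathrm{inv}}]$.
   Context: Let $E=\{0,\dots,n\}$, $T=(\mathbb C^*)^E$ with characters $T_0,\dots,T_n$, and $X_E$ the $n$-dimensional permutohedral variety, the toric variety with dense torus $T/\mathbb C^*$ of the normal fan of the permutohedron; its $T$-fixed points $p_\sigma$ are indexed by permutations $\sigma$ of $E$. By localization, $K^0_T(X_E)$ is identified with the set of tuples $(f_\sigma)_\sigma\in\prod_\sigma\mathbb Z[T_0^{\pm1},\dots,T_n^{\pm1}]$ such that $f_\sigma\equiv f_{\sigma'}\bmod (1-T_{\sigma(i+1)}/T_{\sigma(i)})$ whenever $\sigma'=\sigma\circ(i,i+1)$. $B_\sigma(M)$ is the lexicographically first basis of $M$ for the order $\sigma(0)\prec\cdots\prec\sigma(n)$. $\mathbb C^E_{\mathrm{inv}}$ is $\mathbb C^E$ with $T$ acting by inverse coordinate scaling, so its trivial bundle has class $\sum_{i\in E}T_i^{ -1}$ at every $\sigma$. -}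

module Defs where

open import Data.Nat using (ℕ; suc)
open import Data.Integer as ℤ using (ℤ; +_; -_)
open import Data.Fin using (Fin; inject₁; _<_)
import Data.Fin.Permutation.Components as PC
open import Data.Fin.Permutation using (Permutation′; _⟨$⟩ʳ_)
open import Data.Fin.Subset using (Subset; _∈_; _∉_; ⁅_⁆; _∪_; _∩_; ∁; ⊥)
open import Data.Vec using (Vec; zipWith; replicate; tabulate)
open import Data.Vec.Properties using (≡-dec)
open import Data.List using (List; []; _∷_; _++_; map; concatMap; allFin)
open import Data.Product using (_×_; _,_; Σ; ∃; ∃-syntax)
open import Data.Sum using (_⊎_)
open import Data.Bool using (Bool; true; false; if_then_else_)
open import Relation.Nullary using (Dec; does; ¬_)
open import Relation.Binary.PropositionalEquality using (_≡_; _≢_)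
open import Function.Bundles using (_⇔_)

_─_ : ∀ {m} → Subset m → Fin m → Subset m
B ─ x = B ∩ ∁ ⁅ x ⁆

record Matroid (n : ℕ) : Set₁ where
  field
    IsBasis  : Subset (suc n) → Set
    isBasis? : (B : Subset (suc n)) → Dec (IsBasis B)
    basis-nonempty : ∃[ B ] IsBasis B
    exchange : ∀ B₁ B₂ → IsBasis B₁ → IsBasis B₂ → ∀ x → x ∈ B₁ → x ∉ B₂ →
               ∃[ y ] (y ∈ B₂ × y ∉ B₁ × IsBasis ((B₁ ─ x) ∪ ⁅ y ⁆))

open Matroid public

Perm : ℕ → Set
Perm n = Permutation′ (suc n)

LexLeq : ∀ {n} → Perm n → Subset (suc n) → Subset (suc n) → Set
LexLeq σ B B' =
  B ≡ B' ⊎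
  ∃[ k ] ((∀ j → j < k → (σ ⟨$⟩ʳ j ∈ B) ⇔ (σ ⟨$⟩ʳ j ∈ B'))
          × σ ⟨$⟩ʳ k ∈ B × σ ⟨$⟩ʳ k ∉ B')

IsLexFirstBasis : ∀ {n} → Matroid n → Perm n → Subset (suc n) → Set
IsLexFirstBasis M σ B = IsBasis M B × (∀ B' → IsBasis M B' → LexLeq σ B B')

-- Laurent polynomials ℤ[T₀^{±1},…,T_n^{±1}], represented as finite
-- formal sums of terms  c · T^e  (c ∈ ℤ, e ∈ ℤ^{n+1}), compared by
-- their coefficient functions.

Exp : ℕ → Set
Exp n = Vec ℤ (suc n)

Laurent : ℕ → Set
Laurent n = List (ℤ × Exp n)

coeff : ∀ {n} → Laurent n → Exp n → ℤ
coeff [] e = + 0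
coeff ((c , m) ∷ p) e = (if does (≡-dec ℤ._≟_ m e) then c else + 0) ℤ.+ coeff p e

infix 4 _≈L_
_≈L_ : ∀ {n} → Laurent n → Laurent n → Set
p ≈L q = ∀ e → coeff p e ≡ coeff q e

infixl 6 _+L_ _-L_
infixl 7 _*L_

_+L_ : ∀ {n} → Laurent n → Laurent n → Laurent n
_+L_ = _++_

negL : ∀ {n} → Laurent n → Laurent n
negL = map (λ { (c , m) → (- c , m) })

_-L_ : ∀ {n} → Laurent n → Laurent n → Laurent n
p -L q = p +L negL q

_*L_ : ∀ {n} → Laurent n → Laurent n → Laurent n
p *L q = concatMap (λ { (c , m) → map (λ { (d , m') → (c ℤ.* d , zipWith ℤ._+_ m m') }) q }) p

_∣L_ : ∀ {n} → Laurent n → Laurent n → Set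
p ∣L q = ∃[ r ] (q ≈L p *L r)

_≡_mod_ : ∀ {n} → Laurent n → Laurent n → Laurent n → Set
f ≡ g mod h = h ∣L (f -L g)

unitExp : ∀ {n} → Fin (suc n) → ℤ → Exp n
unitExp i k = tabulate (λ j → if does (i Data.Fin.≟ j) then k else + 0)

oneL : ∀ {n} → Laurent n
oneL = (+ 1 , replicate _ (+ 0)) ∷ []

Tinv : ∀ {n} → Fin (suc n) → Laurent n
Tinv i = (+ 1 , unitExp i (- + 1)) ∷ []

oneMinusRatio : ∀ {n} → Fin (suc n) → Fin (suc n) → Laurent n
oneMinusRatio a b =
  oneL -L ((+ 1 , zipWith ℤ._+_ (unitExp a (+ 1)) (unitExp b (- + 1))) ∷ [])

sumTinv : ∀ {n} → (Fin (suc n) → Bool) → Laurent n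
sumTinv P = concatMap (λ i → if P i then Tinv i else []) (allFin _)

-- K⁰_T(X_E) via localization: tuples (f_σ) satisfying the GKM conditions
-- f_σ ≡ f_σ' mod (1 - T_{σ(i+1)}/T_{σ(i)}) whenever σ' = σ ∘ (i,i+1).

IsSwapAdj : ∀ {n} → Perm n → Perm n → Fin n → Set
IsSwapAdj σ σ' i =
  ∀ k → σ' ⟨$⟩ʳ k ≡ σ ⟨$⟩ʳ (PC.transpose (inject₁ i) (Data.Fin.suc i) k)

InKT : ∀ {n} → (Perm n → Laurent n) → Set
InKT {n} f = ∀ (σ σ' : Perm n) (i : Fin n) → IsSwapAdj σ σ' i →
  f σ ≡ f σ' mod oneMinusRatio (σ ⟨$⟩ʳ Data.Fin.suc i) (σ ⟨$⟩ʳ inject₁ i)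

classS : ∀ {n} → (Perm n → Subset (suc n)) → Perm n → Laurent n
classS B σ = sumTinv (λ i → Data.Vec.lookup (B σ) i)

classQ : ∀ {n} → (Perm n → Subset (suc n)) → Perm n → Laurent n
classQ B σ = sumTinv (λ i → Data.Bool.not (Data.Vec.lookup (B σ) i))

-- [X_E × ℂ^E_inv] : Σ_{i∈E} T_i^{-1} at every σ
classTriv : ∀ {n} → Perm n → Laurent n
classTriv σ = sumTinv (λ _ → true)

-- The classes are sums of T_i⁻¹ over B_σ(M) and over its complement, so they add up to
-- Σ_i T_i⁻¹.  For the GKM condition at σ′ = σ ∘ (p p+1), with a = σ(p) and b = σ(p+1), the
-- point is that B_σ′(M) is either B_σ(M) or B_σ(M) − a + b: comparing the two lex-first bases
-- in both orders forces their first difference to sit at position p, and the dual exchange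
-- property together with lex-minimality then pins B_σ′(M) down.  The two classes therefore
-- differ by 0 or ±(T_a⁻¹ − T_b⁻¹) = ∓ T_b⁻¹ (1 − T_b/T_a).  Existence of B_σ(M) is the
-- existence of a minimum of the finite nonempty set of bases in a total order.

module Submission where

open import Defs
open import Data.Nat as ℕ using (ℕ; suc; s≤s)
import Data.Nat.Properties as ℕP
open import Data.Integer using (ℤ; +_; -_; 0ℤ; _+_; _-_)
import Data.Integer.Properties as ℤP
open import Data.Integer.Solver using (module +-*-Solver)
open import Algebra.Properties.CommutativeMonoid.Sum ℤP.+-0-commutativeMonoid
  using (sum; sum-remove; sum-cong-≗; ∑-distrib-+)
open import Data.Fin as Fin using (Fin; _<_; _≤_; inject₁; toℕ; punchIn)
import Data.Fin.Properties as FinP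
import Data.Fin.Permutation.Components as PC
open import Data.Fin.Permutation using (_⟨$⟩ʳ_; _⟨$⟩ˡ_; inverseˡ; inverseʳ)
open import Data.Fin.Subset using (Subset; _∈_; _∉_; _⊂_; ⁅_⁆; _∪_; _∩_; ∁)
import Data.Fin.Subset.Properties as SubsetP
open import Data.Fin.Subset.Induction using (⊂-wellFounded)
open import Data.Vec as Vec using (Vec; lookup; zipWith)
import Data.Vec.Properties as VecP
open import Data.List as List using (List; []; _∷_; _++_; concatMap; filter)
open import Data.List.Membership.Propositional using () renaming (_∈_ to _∈ₗ_)
open import Data.List.Membership.Propositional.Properties using (∈-++⁺ˡ; ∈-++⁺ʳ; ∈-map⁺; ∈-filter⁺)
open import Data.List.Relation.Unary.Any using (here)
import Data.List.Relation.Unary.All as All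
open import Data.List.Relation.Unary.All.Properties using (all-filter)
open import Data.Product using (_×_; _,_; ∃; ∃-syntax; proj₁)
open import Data.Sum as Sum using (_⊎_; inj₁; inj₂)
open import Data.Bool using (Bool; true; false; not; _∧_; _∨_; if_then_else_)
import Data.Bool.Properties as BoolP
open import Function using (_∘_; _⇔_; mk⇔; Equivalence)
open import Induction.WellFounded using (Acc; acc)
import Relation.Binary.Construct.On as On
open import Relation.Binary using (tri<; tri≈; tri>)
open import Relation.Binary.Bundles using (TotalOrder)
open import Relation.Nullary using (¬_; Dec; does; yes; no; contradiction)
open import Relation.Nullary.Decidable using (_×-dec_; ¬?)
open import Relation.Binary.PropositionalEquality

private
  variable
    m n : ℕ

lookup-≗⇒≡ : ∀ {A : Set} {xs ys : Vec A m} → lookup xs ≗ lookup ys → xs ≡ ys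
lookup-≗⇒≡ {xs = xs} {ys} eq =
  trans (sym (VecP.tabulate∘lookup xs)) (trans (VecP.tabulate-cong eq) (VecP.tabulate∘lookup ys))

record Exchanged (P Q : Fin m → Bool) (u v : Fin m) : Set where
  field
    u∈P : P u ≡ true
    v∉P : P v ≡ false
    u∉Q : Q u ≡ false
    v∈Q : Q v ≡ true
    agree : ∀ x → x ≢ u → x ≢ v → P x ≡ Q x

  u≢v : u ≢ v
  u≢v refl = BoolP.not-¬ u∈P v∉P

Exchanged-not : ∀ {P Q : Fin m → Bool} {u v} → Exchanged P Q u v → Exchanged (not ∘ P) (not ∘ Q) v u
Exchanged-not ex = record
  { u∈P = cong not v∉P ; v∉P = cong not u∈P ; u∉Q = cong not v∈Q ; v∈Q = cong not u∉Q
  ; agree = λ x x≢v x≢u → cong not (agree x x≢u x≢v) }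
  where open Exchanged ex

-- Coefficients of Laurent polynomials

sumOver : (Fin m → Bool) → (Fin m → ℤ) → ℤ
sumOver P c = sum (λ i → if P i then c i else 0ℤ)

sumOver-cong : ∀ {P Q : Fin m → Bool} (c : Fin m → ℤ) → P ≗ Q → sumOver P c ≡ sumOver Q c
sumOver-cong c P≗Q = sum-cong-≗ (λ i → cong (λ b → if b then c i else 0ℤ) (P≗Q i))

sumOver-remove : ∀ {P R : Fin (suc m) → Bool} (c : Fin (suc m) → ℤ) {u} →
  P u ≡ true → R u ≡ false → (∀ i → i ≢ u → P i ≡ R i) →
  sumOver P c ≡ c u + sumOver R c
sumOver-remove {P = P} {R} c {u} Pu Ru P≡R = begin
  sumOver P c                            ≡⟨ sum-remove {i = u} f ⟩
  f u + sum (f ∘ punchIn u)              ≡⟨ cong₂ _+_ (cong (λ b → if b then c u else 0ℤ) Pu) rest ⟩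
  c u + sum (g ∘ punchIn u)              ≡⟨ cong (λ z → c u + z) (sym g-remove) ⟩
  c u + (g u + sum (g ∘ punchIn u))      ≡⟨ cong (λ z → c u + z) (sym (sum-remove {i = u} g)) ⟩
  c u + sumOver R c                      ∎
  where
  open ≡-Reasoning
  f g : Fin (suc _) → ℤ
  f i = if P i then c i else 0ℤ
  g i = if R i then c i else 0ℤ
  rest : sum (f ∘ punchIn u) ≡ sum (g ∘ punchIn u)
  rest = sum-cong-≗ (λ j → cong (λ b → if b then c (punchIn u j) else 0ℤ) (P≡R _ (FinP.punchInᵢ≢i u j)))
  g-remove : g u + sum (g ∘ punchIn u) ≡ sum (g ∘ punchIn u)
  g-remove rewrite Ru = ℤP.+-identityˡ _

sumOver-complement : ∀ (P : Fin m → Bool) c → sumOver P c + sumOver (not ∘ P) c ≡ sum c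
sumOver-complement P c =
  trans (sym (∑-distrib-+ (λ i → if P i then c i else 0ℤ) (λ i → if not (P i) then c i else 0ℤ)))
        (sum-cong-≗ split)
  where
  split : ∀ i → (if P i then c i else 0ℤ) + (if not (P i) then c i else 0ℤ) ≡ c i
  split i with P i
  ... | true  = ℤP.+-identityʳ (c i)
  ... | false = ℤP.+-identityˡ (c i)

coeff-++ : ∀ (p q : Laurent n) e → coeff (p ++ q) e ≡ coeff p e + coeff q e
coeff-++ [] q e = sym (ℤP.+-identityˡ _)
coeff-++ ((c , x) ∷ p) q e =
  trans (cong (λ z → (if does (VecP.≡-dec ℤP._≟_ x e) then c else 0ℤ) + z) (coeff-++ p q e))
        (sym (ℤP.+-assoc (if does (VecP.≡-dec ℤP._≟_ x e) then c else 0ℤ) (coeff p e) (coeff q e)))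

coeff-negL : ∀ (p : Laurent n) e → coeff (negL p) e ≡ - coeff p e
coeff-negL [] e = refl
coeff-negL ((c , x) ∷ p) e =
  trans (cong₂ _+_ (sym (BoolP.if-float -_ (does (VecP.≡-dec ℤP._≟_ x e)) {c} {0ℤ})) (coeff-negL p e))
        (sym (ℤP.neg-distrib-+ (if does (VecP.≡-dec ℤP._≟_ x e) then c else 0ℤ) (coeff p e)))

coeff--L : ∀ (p q : Laurent n) e → coeff (p -L q) e ≡ coeff p e - coeff q e
coeff--L p q e = trans (coeff-++ p (negL q) e) (cong (λ z → coeff p e + z) (coeff-negL q e))

coeff-concatMap-tabulate : ∀ {A : Set} (g : A → Laurent n) (f : Fin m → A) e →
  coeff (concatMap g (List.tabulate f)) e ≡ sum (λ i → coeff (g (f i)) e)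
coeff-concatMap-tabulate {m = ℕ.zero} g f e = refl
coeff-concatMap-tabulate {m = suc m} g f e =
  trans (coeff-++ (g (f Fin.zero)) _ e)
        (cong (λ z → coeff (g (f Fin.zero)) e + z) (coeff-concatMap-tabulate g (f ∘ Fin.suc) e))

coeff-sumTinv : ∀ (P : Fin (suc n) → Bool) e → coeff (sumTinv P) e ≡ sumOver P (λ i → coeff (Tinv i) e)
coeff-sumTinv P e =
  trans (coeff-concatMap-tabulate (λ i → if P i then Tinv i else []) (λ i → i) e)
        (sum-cong-≗ (λ i → BoolP.if-float (λ p → coeff p e) (P i) {Tinv i} {[]}))

sumTinv-exchange : ∀ {P Q : Fin (suc n) → Bool} {u v} → Exchanged P Q u v →
  sumTinv P -L sumTinv Q ≈L Tinv u -L Tinv v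
sumTinv-exchange {P = P} {Q} {u} {v} ex e = begin
  coeff (sumTinv P -L sumTinv Q) e                 ≡⟨ coeff--L (sumTinv P) (sumTinv Q) e ⟩
  coeff (sumTinv P) e - coeff (sumTinv Q) e         ≡⟨ cong₂ _-_ P-sum Q-sum ⟩
  (c u + sumOver R c) - (c v + sumOver R c)         ≡⟨ cancel-+ʳ (c u) (c v) (sumOver R c) ⟩
  c u - c v                                         ≡⟨ sym (coeff--L (Tinv u) (Tinv v) e) ⟩
  coeff (Tinv u -L Tinv v) e                        ∎
  where
  open ≡-Reasoning
  open Exchanged ex
  open +-*-Solver
  cancel-+ʳ : ∀ x y s → (x + s) - (y + s) ≡ x - y
  cancel-+ʳ = solve 3 (λ x y s → (x :+ s) :- (y :+ s) := x :- y) refl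
  c : Fin (suc _) → ℤ
  c i = coeff (Tinv i) e
  R : Fin (suc _) → Bool
  R i = if does (i FinP.≟ u) then false else P i
  R-off : ∀ i → i ≢ u → R i ≡ P i
  R-off i i≢u with i FinP.≟ u
  ... | yes i≡u = contradiction i≡u i≢u
  ... | no _    = refl
  R-at : R u ≡ false
  R-at with u FinP.≟ u
  ... | yes _   = refl
  ... | no u≢u  = contradiction refl u≢u
  P-sum : coeff (sumTinv P) e ≡ c u + sumOver R c
  P-sum = trans (coeff-sumTinv P e) (sumOver-remove c u∈P R-at (λ i i≢u → sym (R-off i i≢u)))
  Q≡R : ∀ i → i ≢ v → Q i ≡ R i
  Q≡R i i≢v with i FinP.≟ u
  ... | yes refl = u∉Q
  ... | no i≢u   = sym (agree i i≢u i≢v)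
  Q-sum : coeff (sumTinv Q) e ≡ c v + sumOver R c
  Q-sum = trans (coeff-sumTinv Q e)
                (sumOver-remove c v∈Q (trans (R-off v (u≢v ∘ sym)) v∉P) Q≡R)

sumTinv-complement : ∀ (P : Fin (suc n) → Bool) → sumTinv P +L sumTinv (not ∘ P) ≈L sumTinv (λ _ → true)
sumTinv-complement P e = begin
  coeff (sumTinv P +L sumTinv (not ∘ P)) e           ≡⟨ coeff-++ (sumTinv P) (sumTinv (not ∘ P)) e ⟩
  coeff (sumTinv P) e + coeff (sumTinv (not ∘ P)) e   ≡⟨ cong₂ _+_ (coeff-sumTinv P e) (coeff-sumTinv (not ∘ P) e) ⟩
  sumOver P c + sumOver (not ∘ P) c                   ≡⟨ sumOver-complement P c ⟩
  sum c                                               ≡⟨ sym (coeff-sumTinv (λ _ → true) e) ⟩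
  coeff (sumTinv (λ _ → true)) e                      ∎
  where
  open ≡-Reasoning
  c : Fin (suc _) → ℤ
  c i = coeff (Tinv i) e

lookup-unitExp : ∀ (i : Fin (suc n)) k j → lookup (unitExp i k) j ≡ (if does (i FinP.≟ j) then k else 0ℤ)
lookup-unitExp i k = VecP.lookup∘tabulate (λ j → if does (i FinP.≟ j) then k else 0ℤ)

unitExp-ratio : ∀ (a b : Fin (suc n)) →
  zipWith _+_ (zipWith _+_ (unitExp b (+ 1)) (unitExp a (- + 1))) (unitExp b (- + 1)) ≡ unitExp a (- + 1)
unitExp-ratio a b = lookup-≗⇒≡ pointwise
  where
  open ≡-Reasoning
  cancel : ∀ x y → ((if x then + 1 else 0ℤ) + (if y then - + 1 else 0ℤ)) + (if x then - + 1 else 0ℤ)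
                   ≡ (if y then - + 1 else 0ℤ)
  cancel true  true  = refl
  cancel true  false = refl
  cancel false true  = refl
  cancel false false = refl
  pointwise : ∀ j → lookup (zipWith _+_ (zipWith _+_ (unitExp b (+ 1)) (unitExp a (- + 1))) (unitExp b (- + 1))) j
                    ≡ lookup (unitExp a (- + 1)) j
  pointwise j = begin
    lookup (zipWith _+_ (zipWith _+_ (unitExp b (+ 1)) (unitExp a (- + 1))) (unitExp b (- + 1))) j
      ≡⟨ VecP.lookup-zipWith _+_ j (zipWith _+_ (unitExp b (+ 1)) (unitExp a (- + 1))) (unitExp b (- + 1)) ⟩
    lookup (zipWith _+_ (unitExp b (+ 1)) (unitExp a (- + 1))) j + lookup (unitExp b (- + 1)) j
      ≡⟨ cong₂ _+_ (trans (VecP.lookup-zipWith _+_ j (unitExp b (+ 1)) (unitExp a (- + 1)))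
                          (cong₂ _+_ (lookup-unitExp b _ j) (lookup-unitExp a _ j)))
                   (lookup-unitExp b _ j) ⟩
    ((if does (b FinP.≟ j) then + 1 else 0ℤ) + (if does (a FinP.≟ j) then - + 1 else 0ℤ))
      + (if does (b FinP.≟ j) then - + 1 else 0ℤ)
      ≡⟨ cancel (does (b FinP.≟ j)) (does (a FinP.≟ j)) ⟩
    (if does (a FinP.≟ j) then - + 1 else 0ℤ)
      ≡⟨ sym (lookup-unitExp a _ j) ⟩
    lookup (unitExp a (- + 1)) j
      ∎

oneMinusRatio-*-monomial : ∀ (a b : Fin (suc n)) s →
  oneMinusRatio b a *L ((s , unitExp b (- + 1)) ∷ [])
  ≡ (s , unitExp b (- + 1)) ∷ (- s , unitExp a (- + 1)) ∷ []
oneMinusRatio-*-monomial a b s =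
  cong₂ (λ x y → x ∷ y ∷ [])
    (cong₂ _,_ (ℤP.*-identityˡ s) (VecP.zipWith-identityˡ ℤP.+-identityˡ (unitExp b (- + 1))))
    (cong₂ _,_ (ℤP.-1*i≡-i s) (unitExp-ratio a b))

coeff-++-comm : ∀ (p q : Laurent n) e → coeff (p ++ q) e ≡ coeff (q ++ p) e
coeff-++-comm p q e = trans (coeff-++ p q e) (trans (ℤP.+-comm (coeff p e) (coeff q e)) (sym (coeff-++ q p e)))

oneMinusRatio-∣-Tinv-Tinv : ∀ (a b : Fin (suc n)) → oneMinusRatio b a ∣L (Tinv a -L Tinv b)
oneMinusRatio-∣-Tinv-Tinv a b = ((- + 1 , unitExp b (- + 1)) ∷ []) , λ e →
  trans (coeff-++-comm (Tinv a) (negL (Tinv b)) e)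
        (cong (λ p → coeff p e) (sym (oneMinusRatio-*-monomial a b (- + 1))))

oneMinusRatio-∣-Tinv-Tinv′ : ∀ (a b : Fin (suc n)) → oneMinusRatio b a ∣L (Tinv b -L Tinv a)
oneMinusRatio-∣-Tinv-Tinv′ a b = ((+ 1 , unitExp b (- + 1)) ∷ []) , λ e →
  cong (λ p → coeff p e) (sym (oneMinusRatio-*-monomial a b (+ 1)))

sumTinv-cong : ∀ {P Q : Fin (suc n) → Bool} → P ≗ Q → sumTinv P ≈L sumTinv Q
sumTinv-cong {P = P} {Q} P≗Q e =
  trans (coeff-sumTinv P e) (trans (sumOver-cong (λ i → coeff (Tinv i) e) P≗Q) (sym (coeff-sumTinv Q e)))

sumTinv-≡mod : ∀ {P Q : Fin (suc n) → Bool} {a b} →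
  P ≗ Q ⊎ Exchanged P Q a b ⊎ Exchanged P Q b a →
  sumTinv P ≡ sumTinv Q mod oneMinusRatio b a
sumTinv-≡mod {P = P} {Q} (inj₁ P≗Q) = [] , λ e → begin
  coeff (sumTinv P -L sumTinv Q) e          ≡⟨ coeff--L (sumTinv P) (sumTinv Q) e ⟩
  coeff (sumTinv P) e - coeff (sumTinv Q) e  ≡⟨ cong (λ z → z - coeff (sumTinv Q) e) (sumTinv-cong P≗Q e) ⟩
  coeff (sumTinv Q) e - coeff (sumTinv Q) e  ≡⟨ ℤP.+-inverseʳ (coeff (sumTinv Q) e) ⟩
  0ℤ                                        ∎
  where open ≡-Reasoning
sumTinv-≡mod {a = a} {b} (inj₂ (inj₁ ex)) with oneMinusRatio-∣-Tinv-Tinv a b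
... | r , ∣r = r , λ e → trans (sumTinv-exchange ex e) (∣r e)
sumTinv-≡mod {a = a} {b} (inj₂ (inj₂ ex)) with oneMinusRatio-∣-Tinv-Tinv′ a b
... | r , ∣r = r , λ e → trans (sumTinv-exchange ex e) (∣r e)

-- Lexicographic order on Boolean words

Agree : (f g : Fin m → Bool) → Fin m → Set
Agree f g k = ∀ j → j < k → f j ≡ g j

LeadsAt : (f g : Fin m → Bool) → Fin m → Set
LeadsAt f g k = Agree f g k × f k ≡ true × g k ≡ false

infix 4 _≺_ _≼_

_≺_ : (f g : Fin m → Bool) → Set
f ≺ g = ∃ (LeadsAt f g)

_≼_ : (f g : Fin m → Bool) → Set
f ≼ g = f ≗ g ⊎ f ≺ g

LeadsAt-resp : ∀ {f f′ g g′ : Fin m → Bool} {k} → f ≗ f′ → g ≗ g′ → LeadsAt f g k → LeadsAt f′ g′ k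
LeadsAt-resp f≗f′ g≗g′ (agree , fk , gk) =
  (λ j j<k → trans (sym (f≗f′ j)) (trans (agree j j<k) (g≗g′ j))) ,
  trans (sym (f≗f′ _)) fk , trans (sym (g≗g′ _)) gk

≼-resp : ∀ {f f′ g g′ : Fin m → Bool} → f ≗ f′ → g ≗ g′ → f ≼ g → f′ ≼ g′
≼-resp f≗f′ g≗g′ (inj₁ f≗g) = inj₁ λ x → trans (sym (f≗f′ x)) (trans (f≗g x) (g≗g′ x))
≼-resp f≗f′ g≗g′ (inj₂ (k , lead)) = inj₂ (k , LeadsAt-resp f≗f′ g≗g′ lead)

≺⇒⋡ : ∀ {f g : Fin m → Bool} → f ≺ g → ¬ g ≼ f
≺⇒⋡ (k , _ , fk , gk) (inj₁ g≗f) = BoolP.not-¬ fk (trans (sym (g≗f k)) gk)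
≺⇒⋡ (k , agree , fk , gk) (inj₂ (k′ , agree′ , gk′ , fk′)) with FinP.<-cmp k k′
... | tri< k<k′ _ _ = BoolP.not-¬ fk (trans (sym (agree′ k k<k′)) gk)
... | tri≈ _ refl _ = BoolP.not-¬ fk fk′
... | tri> _ _ k′<k = BoolP.not-¬ gk′ (trans (sym (agree k′ k′<k)) fk′)

≼-antisym : ∀ {f g : Fin m → Bool} → f ≼ g → g ≼ f → f ≗ g
≼-antisym (inj₁ f≗g) _ = f≗g
≼-antisym (inj₂ f≺g) g≼f = contradiction g≼f (≺⇒⋡ f≺g)

≺-trans : ∀ {f g h : Fin m → Bool} → f ≺ g → g ≺ h → f ≺ h
≺-trans (k , agree , fk , gk) (k′ , agree′ , gk′ , hk′) with FinP.<-cmp k k′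
... | tri< k<k′ _ _ =
  k , (λ j j<k → trans (agree j j<k) (agree′ j (FinP.<-trans j<k k<k′))) , fk , trans (sym (agree′ k k<k′)) gk
... | tri≈ _ refl _ = contradiction (trans (sym gk′) gk) λ ()
... | tri> _ _ k′<k =
  k′ , (λ j j<k′ → trans (agree j (FinP.<-trans j<k′ k′<k)) (agree′ j j<k′)) ,
  trans (agree k′ k′<k) gk′ , hk′

≼-trans : ∀ {f g h : Fin m → Bool} → f ≼ g → g ≼ h → f ≼ h
≼-trans (inj₁ f≗g) g≼h = ≼-resp (sym ∘ f≗g) (λ _ → refl) g≼h
≼-trans (inj₂ f≺g) (inj₁ g≗h) = ≼-resp (λ _ → refl) g≗h (inj₂ f≺g)
≼-trans (inj₂ f≺g) (inj₂ g≺h) = inj₂ (≺-trans f≺g g≺h)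

firstDifference : ∀ (f g : Fin m → Bool) → f ≗ g ⊎ ∃[ k ] Agree f g k × f k ≢ g k
firstDifference {ℕ.zero} f g = inj₁ λ ()
firstDifference {suc m} f g with f Fin.zero BoolP.≟ g Fin.zero | firstDifference (f ∘ Fin.suc) (g ∘ Fin.suc)
... | no f₀≢g₀ | _ = inj₂ (Fin.zero , (λ _ ()) , f₀≢g₀)
... | yes f₀≡g₀ | inj₁ f≗g = inj₁ λ { Fin.zero → f₀≡g₀ ; (Fin.suc k) → f≗g k }
... | yes f₀≡g₀ | inj₂ (k , agree , fk≢gk) =
  inj₂ (Fin.suc k , (λ { Fin.zero _ → f₀≡g₀ ; (Fin.suc j) (s≤s j<k) → agree j j<k }) , fk≢gk)

≼-total : ∀ (f g : Fin m → Bool) → f ≼ g ⊎ g ≼ f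
≼-total f g with firstDifference f g
... | inj₁ f≗g = inj₁ (inj₁ f≗g)
... | inj₂ (k , agree , fk≢gk) with f k in fk | g k in gk
...   | true  | false = inj₁ (inj₂ (k , agree , fk , gk))
...   | false | true  = inj₂ (inj₂ (k , (λ j j<k → sym (agree j j<k)) , gk , fk))
...   | true  | true  = contradiction refl fk≢gk
...   | false | false = contradiction refl fk≢gk

-- Transpositions

module _ {n : ℕ} (i j : Fin n) where
  private
    t = PC.transpose i j

  transpose-matchˡ : t i ≡ j
  transpose-matchˡ with i FinP.≟ i
  ... | yes _   = refl
  ... | no i≢i  = contradiction refl i≢i

  transpose-matchʳ : t j ≡ i
  transpose-matchʳ with j FinP.≟ i
  ... | yes refl = refl
  ... | no _ with j FinP.≟ j
  ...   | yes _   = refl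
  ...   | no j≢j  = contradiction refl j≢j

  transpose-other : ∀ {k} → k ≢ i → k ≢ j → t k ≡ k
  transpose-other {k} k≢i k≢j with k FinP.≟ i
  ... | yes k≡i = contradiction k≡i k≢i
  ... | no _ with k FinP.≟ j
  ...   | yes k≡j = contradiction k≡j k≢j
  ...   | no _    = refl

  transpose-involutive : ∀ k → t (t k) ≡ k
  transpose-involutive k = by-cases (k FinP.≟ i) (k FinP.≟ j)
    where
    by-cases : Dec (k ≡ i) → Dec (k ≡ j) → t (t k) ≡ k
    by-cases (yes refl) _        = trans (cong t transpose-matchˡ) transpose-matchʳ
    by-cases (no _)     (yes refl) = trans (cong t transpose-matchʳ) transpose-matchˡ
    by-cases (no k≢i)   (no k≢j)   = trans (cong t (transpose-other k≢i k≢j)) (transpose-other k≢i k≢j)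

  transpose-< : ∀ {k l : Fin n} → k < l → i < l → j < l → t k < l
  transpose-< {k} {l} k<l i<l j<l = by-cases (k FinP.≟ i) (k FinP.≟ j)
    where
    by-cases : Dec (k ≡ i) → Dec (k ≡ j) → t k < l
    by-cases (yes refl) _          = subst (_< l) (sym transpose-matchˡ) j<l
    by-cases (no _)     (yes refl) = subst (_< l) (sym transpose-matchʳ) i<l
    by-cases (no k≢i)   (no k≢j)   = subst (_< l) (sym (transpose-other k≢i k≢j)) k<l

module AdjacentTransposition {m : ℕ} (i : Fin m) where
  p q : Fin (suc m)
  p = inject₁ i
  q = Fin.suc i

  t : Fin (suc m) → Fin (suc m)
  t = PC.transpose p q

  p<q : p < q
  p<q = FinP.≤̄⇒inject₁< FinP.≤-refl

  p<k⇒q≤k : ∀ {k : Fin (suc m)} → p < k → q ≤ k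
  p<k⇒q≤k {k} = subst (λ x → x ℕ.< toℕ k) (FinP.toℕ-inject₁ i)

  k<q⇒k≤p : ∀ {k : Fin (suc m)} → k < q → k ≤ p
  k<q⇒k≤p {k} k<q = subst (toℕ k ℕ.≤_) (sym (FinP.toℕ-inject₁ i)) (ℕP.≤-pred k<q)

  t-below-p : ∀ {j} → j < p → t j ≡ j
  t-below-p j<p = transpose-other p q (FinP.<⇒≢ j<p) (FinP.<⇒≢ (FinP.<-trans j<p p<q))

  LeadsAt-transpose : ∀ {f g : Fin (suc m) → Bool} {k} → LeadsAt f g k → k ≢ p → f ∘ t ≺ g ∘ t
  LeadsAt-transpose {f} {g} {k} (agree , fk , gk) k≢p with FinP.<-cmp k p
  ... | tri< k<p _ _ =
    k , agree′ , subst (λ x → f x ≡ true) (sym k-fixed) fk , subst (λ x → g x ≡ false) (sym k-fixed) gk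
    where
    k-fixed : t k ≡ k
    k-fixed = t-below-p k<p
    agree′ : Agree (f ∘ t) (g ∘ t) k
    agree′ j j<k = subst (λ x → f x ≡ g x) (sym (t-below-p (FinP.<-trans j<k k<p))) (agree j j<k)
  ... | tri≈ _ k≡p _ = contradiction k≡p k≢p
  ... | tri> _ _ p<k with FinP.<-cmp k q
  ...   | tri< k<q _ _ = contradiction (p<k⇒q≤k p<k) (ℕP.<⇒≱ k<q)
  ...   | tri≈ _ refl _ =
    p , (λ j j<p → subst (λ x → f x ≡ g x) (sym (t-below-p j<p)) (agree j (FinP.<-trans j<p p<q))) ,
    subst (λ x → f x ≡ true) (sym (transpose-matchˡ p q)) fk ,
    subst (λ x → g x ≡ false) (sym (transpose-matchˡ p q)) gk
  ...   | tri> _ _ q<k =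
    k , (λ j j<k → agree (t j) (transpose-< p q j<k p<k q<k)) ,
    subst (λ x → f x ≡ true) (sym k-fixed) fk , subst (λ x → g x ≡ false) (sym k-fixed) gk
    where
    k-fixed : t k ≡ k
    k-fixed = transpose-other p q k≢p (FinP.<⇒≢ q<k ∘ sym)

  ∘t-cancel : ∀ {h h′ : Fin (suc m) → Bool} → h ∘ t ≗ h′ ∘ t → h ≗ h′
  ∘t-cancel {h} {h′} eq x =
    trans (cong h (sym (transpose-involutive p q x))) (trans (eq (t x)) (cong h′ (transpose-involutive p q x)))

  ∘t-involutive : ∀ (h : Fin (suc m) → Bool) → h ∘ t ∘ t ≗ h
  ∘t-involutive h = cong h ∘ transpose-involutive p q

  ≼-transpose-cases : ∀ {f g : Fin (suc m) → Bool} → f ≼ g → g ∘ t ≼ f ∘ t →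
    f ≗ g ⊎ (LeadsAt f g p × LeadsAt (g ∘ t) (f ∘ t) p)
  ≼-transpose-cases (inj₁ f≗g) _ = inj₁ f≗g
  ≼-transpose-cases {f} {g} (inj₂ (k , lead)) gt≼ft = by-cases (k FinP.≟ p)
    where
    by-cases : Dec (k ≡ p) → f ≗ g ⊎ (LeadsAt f g p × LeadsAt (g ∘ t) (f ∘ t) p)
    by-cases (no k≢p)   = contradiction gt≼ft (≺⇒⋡ (LeadsAt-transpose lead k≢p))
    by-cases (yes refl) = second gt≼ft
      where
      second : g ∘ t ≼ f ∘ t → f ≗ g ⊎ (LeadsAt f g p × LeadsAt (g ∘ t) (f ∘ t) p)
      second (inj₁ gt≗ft) = contradiction (inj₁ (∘t-cancel gt≗ft)) (≺⇒⋡ (p , lead))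
      second (inj₂ (k′ , lead′)) = by-cases′ (k′ FinP.≟ p)
        where
        by-cases′ : Dec (k′ ≡ p) → f ≗ g ⊎ (LeadsAt f g p × LeadsAt (g ∘ t) (f ∘ t) p)
        by-cases′ (yes refl) = inj₂ (lead , lead′)
        by-cases′ (no k′≢p) with LeadsAt-transpose lead′ k′≢p
        ... | l , lead″ =
          contradiction (inj₂ (p , lead)) (≺⇒⋡ (l , LeadsAt-resp (∘t-involutive g) (∘t-involutive f) lead″))

-- Subsets read along a permutation

∈⇒true : ∀ {x : Fin m} {X} → x ∈ X → lookup X x ≡ true
∈⇒true = VecP.[]=⇒lookup

true⇒∈ : ∀ {x : Fin m} {X} → lookup X x ≡ true → x ∈ X
true⇒∈ = VecP.lookup⇒[]= _ _

∉⇒false : ∀ {x : Fin m} {X} → x ∉ X → lookup X x ≡ false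
∉⇒false x∉X = BoolP.¬-not (x∉X ∘ true⇒∈)

false⇒∉ : ∀ {x : Fin m} {X} → lookup X x ≡ false → x ∉ X
false⇒∉ Xx≡false x∈X = BoolP.not-¬ (∈⇒true x∈X) Xx≡false

⇔⇒lookup≡ : ∀ {x : Fin m} {X Y} → (x ∈ X ⇔ x ∈ Y) → lookup X x ≡ lookup Y x
⇔⇒lookup≡ {x = x} {X} iff with lookup X x in Xx
... | true  = sym (∈⇒true (Equivalence.to iff (true⇒∈ Xx)))
... | false = sym (∉⇒false (false⇒∉ Xx ∘ Equivalence.from iff))

lookup≡⇒⇔ : ∀ {x : Fin m} {X Y} → lookup X x ≡ lookup Y x → (x ∈ X ⇔ x ∈ Y)
lookup≡⇒⇔ eq =
  mk⇔ (λ x∈X → true⇒∈ (trans (sym eq) (∈⇒true x∈X))) (λ x∈Y → true⇒∈ (trans eq (∈⇒true x∈Y)))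

lookup-exchange : ∀ (X : Subset m) u v x →
  lookup ((X ─ u) ∪ ⁅ v ⁆) x ≡ (lookup X x ∧ not (lookup ⁅ u ⁆ x)) ∨ lookup ⁅ v ⁆ x
lookup-exchange X u v x =
  trans (VecP.lookup-zipWith _∨_ x (X ─ u) ⁅ v ⁆)
        (cong (_∨ lookup ⁅ v ⁆ x)
              (trans (VecP.lookup-zipWith _∧_ x X (∁ ⁅ u ⁆))
                     (cong (lookup X x ∧_) (VecP.lookup-map x not ⁅ u ⁆))))

exchange-Exchanged : ∀ {X : Subset m} {u v} → lookup X u ≡ true → lookup X v ≡ false →
  Exchanged (lookup X) (lookup ((X ─ u) ∪ ⁅ v ⁆)) u v
exchange-Exchanged {X = X} {u} {v} Xu Xv = record
  { u∈P = Xu ; v∉P = Xv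
  ; u∉Q = begin
      lookup ((X ─ u) ∪ ⁅ v ⁆) u
        ≡⟨ lookup-exchange X u v u ⟩
      (lookup X u ∧ not (lookup ⁅ u ⁆ u)) ∨ lookup ⁅ v ⁆ u
        ≡⟨ cong₂ (λ a b → (lookup X u ∧ not a) ∨ b) (in-⁅⁆ u) (out-⁅⁆ u≢v) ⟩
      (lookup X u ∧ false) ∨ false
        ≡⟨ cong (_∨ false) (BoolP.∧-zeroʳ (lookup X u)) ⟩
      false
        ∎
  ; v∈Q = trans (lookup-exchange X u v v)
                (trans (cong ((lookup X v ∧ not (lookup ⁅ u ⁆ v)) ∨_) (in-⁅⁆ v)) (BoolP.∨-zeroʳ _))
  ; agree = λ x x≢u x≢v → sym (begin
      lookup ((X ─ u) ∪ ⁅ v ⁆) x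
        ≡⟨ lookup-exchange X u v x ⟩
      (lookup X x ∧ not (lookup ⁅ u ⁆ x)) ∨ lookup ⁅ v ⁆ x
        ≡⟨ cong₂ (λ a b → (lookup X x ∧ not a) ∨ b) (out-⁅⁆ x≢u) (out-⁅⁆ x≢v) ⟩
      (lookup X x ∧ true) ∨ false
        ≡⟨ trans (BoolP.∨-identityʳ _) (BoolP.∧-identityʳ _) ⟩
      lookup X x
        ∎)
  }
  where
  open ≡-Reasoning
  u≢v : u ≢ v
  u≢v refl = BoolP.not-¬ Xu Xv
  in-⁅⁆ : ∀ (y : Fin _) → lookup ⁅ y ⁆ y ≡ true
  in-⁅⁆ y = ∈⇒true (SubsetP.x∈⁅x⁆ y)
  out-⁅⁆ : ∀ {x y : Fin _} → x ≢ y → lookup ⁅ y ⁆ x ≡ false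
  out-⁅⁆ x≢y = ∉⇒false (SubsetP.x≢y⇒x∉⁅y⁆ x≢y)

word : Perm n → Subset (suc n) → Fin (suc n) → Bool
word σ X k = lookup X (σ ⟨$⟩ʳ k)

⟨$⟩ʳ-injective : ∀ (σ : Perm n) {j k} → σ ⟨$⟩ʳ j ≡ σ ⟨$⟩ʳ k → j ≡ k
⟨$⟩ʳ-injective σ {j} {k} eq = trans (sym (inverseˡ σ)) (trans (cong (σ ⟨$⟩ˡ_) eq) (inverseˡ σ))

word-injective : ∀ (σ : Perm n) {X Y} → word σ X ≗ word σ Y → X ≡ Y
word-injective σ {X} {Y} eq =
  lookup-≗⇒≡ λ x → subst (λ z → lookup X z ≡ lookup Y z) (inverseʳ σ) (eq (σ ⟨$⟩ˡ x))

LexLeq⇒≼ : ∀ (σ : Perm n) {X Y} → LexLeq σ X Y → word σ X ≼ word σ Y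
LexLeq⇒≼ σ (inj₁ refl) = inj₁ λ _ → refl
LexLeq⇒≼ σ (inj₂ (k , agree , Xk , Yk)) =
  inj₂ (k , (λ j j<k → ⇔⇒lookup≡ (agree j j<k)) , ∈⇒true Xk , ∉⇒false Yk)

≼⇒LexLeq : ∀ (σ : Perm n) {X Y} → word σ X ≼ word σ Y → LexLeq σ X Y
≼⇒LexLeq σ (inj₁ eq) = inj₁ (word-injective σ eq)
≼⇒LexLeq σ (inj₂ (k , agree , Xk , Yk)) =
  inj₂ (k , (λ j j<k → lookup≡⇒⇔ (agree j j<k)) , true⇒∈ Xk , false⇒∉ Yk)

word-swap : ∀ {σ σ′ : Perm n} {i} → IsSwapAdj σ σ′ i → ∀ X →
  word σ′ X ≗ word σ X ∘ AdjacentTransposition.t i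
word-swap swap X k = cong (lookup X) (swap k)

Exchanged-word : ∀ (τ : Perm n) {X Y j k} → Exchanged (lookup X) (lookup Y) (τ ⟨$⟩ʳ j) (τ ⟨$⟩ʳ k) →
  word τ Y ≗ word τ X ∘ PC.transpose j k
Exchanged-word τ {X} {Y} {j} {k} ex l = by-cases (l FinP.≟ j) (l FinP.≟ k)
  where
  open Exchanged ex
  by-cases : Dec (l ≡ j) → Dec (l ≡ k) → word τ Y l ≡ word τ X (PC.transpose j k l)
  by-cases (yes refl) _ = trans u∉Q (trans (sym v∉P) (cong (word τ X) (sym (transpose-matchˡ j k))))
  by-cases (no _) (yes refl) = trans v∈Q (trans (sym u∈P) (cong (word τ X) (sym (transpose-matchʳ j k))))
  by-cases (no l≢j) (no l≢k) =
    trans (sym (agree _ (l≢j ∘ ⟨$⟩ʳ-injective τ) (l≢k ∘ ⟨$⟩ʳ-injective τ)))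
          (cong (word τ X) (sym (transpose-other j k l≢j l≢k)))

module _ (i : Fin n) where
  open AdjacentTransposition i

  -- Exchanging the letters at positions p and q of a σ-word gives a σ′-word, so the
  -- two hypotheses compare the same pair of words in opposite directions.
  exchanged-lex-unique : ∀ {σ σ′ : Perm n} → IsSwapAdj σ σ′ i → ∀ {B B′ C C′} →
    Exchanged (lookup B) (lookup C) (σ ⟨$⟩ʳ p) (σ ⟨$⟩ʳ q) →
    Exchanged (lookup B′) (lookup C′) (σ′ ⟨$⟩ʳ p) (σ′ ⟨$⟩ʳ q) →
    LexLeq σ B C′ → LexLeq σ′ B′ C → B′ ≡ C
  exchanged-lex-unique {σ} {σ′} swap {B} {B′} {C} {C′} C-exchanged C′-exchanged B≤C′ B′≤C =
    word-injective σ (∘t-cancel λ x →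
      trans (sym (swapped B′ x)) (trans (sym (wC′≗w′B′ x)) (trans (sym (wB≗wC′ x)) (sym (wC∘t≗wB x)))))
    where
    swapped : ∀ X → word σ′ X ≗ word σ X ∘ t
    swapped = word-swap {σ = σ} {σ′} swap
    wC′≗w′B′ : word σ C′ ≗ word σ′ B′
    wC′≗w′B′ = ∘t-cancel λ x → trans (sym (swapped C′ x)) (Exchanged-word σ′ {B′} {C′} C′-exchanged x)
    wC∘t≗wB : word σ C ∘ t ≗ word σ B
    wC∘t≗wB x = trans (Exchanged-word σ {B} {C} C-exchanged (t x)) (∘t-involutive (word σ B) x)
    wB≗wC′ : word σ B ≗ word σ C′
    wB≗wC′ = ≼-antisym (LexLeq⇒≼ σ B≤C′)
                       (≼-resp (sym ∘ wC′≗w′B′) (λ x → trans (swapped C x) (wC∘t≗wB x))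
                               (LexLeq⇒≼ σ′ B′≤C))

lexTotalOrder : Perm n → TotalOrder _ _ _
lexTotalOrder {n} σ = record
  { Carrier = Subset (suc n)
  ; _≈_ = _≡_
  ; _≤_ = LexLeq σ
  ; isTotalOrder = record
    { isPartialOrder = record
      { isPreorder = record
        { isEquivalence = isEquivalence
        ; reflexive = inj₁
        ; trans = λ X≤Y Y≤Z → ≼⇒LexLeq σ (≼-trans (LexLeq⇒≼ σ X≤Y) (LexLeq⇒≼ σ Y≤Z))
        }
      ; antisym = λ X≤Y Y≤X → word-injective σ (≼-antisym (LexLeq⇒≼ σ X≤Y) (LexLeq⇒≼ σ Y≤X))
      }
    ; total = λ X Y → Sum.map (≼⇒LexLeq σ) (≼⇒LexLeq σ) (≼-total (word σ X) (word σ Y))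
    }
  }

allSubsets : ∀ m → List (Subset m)
allSubsets ℕ.zero = Vec.[] ∷ []
allSubsets (suc m) = List.map (true Vec.∷_) (allSubsets m) ++ List.map (false Vec.∷_) (allSubsets m)

∈-allSubsets : ∀ (X : Subset m) → X ∈ₗ allSubsets m
∈-allSubsets Vec.[] = here refl
∈-allSubsets (true Vec.∷ X) = ∈-++⁺ˡ (∈-map⁺ (true Vec.∷_) (∈-allSubsets X))
∈-allSubsets {suc m} (false Vec.∷ X) =
  ∈-++⁺ʳ (List.map (true Vec.∷_) (allSubsets m)) (∈-map⁺ (false Vec.∷_) (∈-allSubsets X))

-- Bases of a matroid

module _ (M : Matroid n) where

  basisExchange : ∀ {X Y x} → IsBasis M X → IsBasis M Y → lookup X x ≡ true → lookup Y x ≡ false →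
    ∃[ y ] lookup Y y ≡ true × lookup X y ≡ false × IsBasis M ((X ─ x) ∪ ⁅ y ⁆)
  basisExchange bX bY Xx Yx with exchange M _ _ bX bY _ (true⇒∈ Xx) (false⇒∉ Yx)
  ... | y , y∈Y , y∉X , b = y , ∈⇒true y∈Y , ∉⇒false y∉X , b

  private
    ∈-∩∁⁺ : ∀ {X Y : Subset (suc n)} {x} → lookup Y x ≡ true → lookup X x ≡ false → x ∈ Y ∩ ∁ X
    ∈-∩∁⁺ Yx Xx = SubsetP.x∈p∩q⁺ (true⇒∈ Yx , SubsetP.x∉p⇒x∈∁p (false⇒∉ Xx))

    ∈-∩∁⁻ : ∀ {X Y : Subset (suc n)} {x} → x ∈ Y ∩ ∁ X → lookup Y x ≡ true × lookup X x ≡ false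
    ∈-∩∁⁻ {X} {Y} x∈ with SubsetP.x∈p∩q⁻ Y (∁ X) x∈
    ... | x∈Y , x∈∁X = ∈⇒true x∈Y , ∉⇒false (SubsetP.x∈∁p⇒x∉p x∈∁X)

  -- Induction on Y ∖ X: while Y ∖ X has an element w ≠ y, exchange it out of Y towards X.
  dualBasisExchange : ∀ {X Y y} → IsBasis M X → IsBasis M Y → lookup Y y ≡ true → lookup X y ≡ false →
    ∃[ x ] lookup X x ≡ true × lookup Y x ≡ false × IsBasis M ((X ─ x) ∪ ⁅ y ⁆)
  dualBasisExchange {X} {Y} bX = go (On.wellFounded (λ Z → Z ∩ ∁ X) ⊂-wellFounded Y)
    where
    _⊏_ : Subset (suc n) → Subset (suc n) → Set
    Z ⊏ W = Z ∩ ∁ X ⊂ W ∩ ∁ X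

    go : ∀ {Y y} → Acc _⊏_ Y → IsBasis M Y → lookup Y y ≡ true → lookup X y ≡ false →
      ∃[ x ] lookup X x ≡ true × lookup Y x ≡ false × IsBasis M ((X ─ x) ∪ ⁅ y ⁆)
    go {Y} {y} (acc rec) bY Yy Xy =
      by-cases (FinP.any? λ w → (lookup Y w BoolP.≟ true ×-dec lookup X w BoolP.≟ false) ×-dec ¬? (w FinP.≟ y))
      where
      by-cases : Dec (∃ λ w → (lookup Y w ≡ true × lookup X w ≡ false) × w ≢ y) →
        ∃[ x ] lookup X x ≡ true × lookup Y x ≡ false × IsBasis M ((X ─ x) ∪ ⁅ y ⁆)
      by-cases (no only-y) with basisExchange bY bX Yy Xy
      ... | x , Xx , Yx , _ with basisExchange bX bY Xx Yx
      ...   | y′ , Yy′ , Xy′ , b with y′ FinP.≟ y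
      ...     | yes refl = x , Xx , Yx , b
      ...     | no y′≢y  = contradiction (y′ , (Yy′ , Xy′) , y′≢y) only-y
      by-cases (yes (w , (Yw , Xw) , w≢y)) = step (basisExchange bY bX Yw Xw)
        where
        step : ∃[ v ] lookup X v ≡ true × lookup Y v ≡ false × IsBasis M ((Y ─ w) ∪ ⁅ v ⁆) →
          ∃[ x ] lookup X x ≡ true × lookup Y x ≡ false × IsBasis M ((X ─ x) ∪ ⁅ y ⁆)
        step (v , Xv , Yv , bY′) = finish (go (rec Y′⊏Y) bY′ Y′y Xy)
          where
          Y′ = (Y ─ w) ∪ ⁅ v ⁆
          open Exchanged (exchange-Exchanged {X = Y} Yw Yv)
          ≢v : ∀ {z} → lookup X z ≡ false → z ≢ v
          ≢v Xz refl = BoolP.not-¬ Xv Xz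
          Y′y : lookup Y′ y ≡ true
          Y′y = trans (sym (agree y (w≢y ∘ sym) (≢v Xy))) Yy
          Y′⊏Y : Y′ ∩ ∁ X ⊂ Y ∩ ∁ X
          Y′⊏Y = (λ z∈ → let (Y′z , Xz) = ∈-∩∁⁻ z∈ in
                           ∈-∩∁⁺ (trans (agree _ (λ { refl → BoolP.not-¬ Y′z u∉Q }) (≢v Xz)) Y′z) Xz)
                 , w , ∈-∩∁⁺ Yw Xw , (λ w∈ → BoolP.not-¬ (proj₁ (∈-∩∁⁻ w∈)) u∉Q)
          finish : ∃[ x ] lookup X x ≡ true × lookup Y′ x ≡ false × IsBasis M ((X ─ x) ∪ ⁅ y ⁆) →
            ∃[ x ] lookup X x ≡ true × lookup Y x ≡ false × IsBasis M ((X ─ x) ∪ ⁅ y ⁆)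
          finish (x , Xx , Y′x , b) =
            x , Xx , trans (agree x (λ { refl → BoolP.not-¬ Xx Xw }) (λ { refl → BoolP.not-¬ v∈Q Y′x })) Y′x
              , b

  lexFirstBasis-exists : ∀ σ → ∃[ B ] IsLexFirstBasis M σ B
  lexFirstBasis-exists σ with basis-nonempty M
  ... | B₀ , B₀-basis = min B₀ bases , min-basis , min-first
    where
    open import Data.List.Extrema (lexTotalOrder σ) using (min; min≤xs; argmin-all)
    bases : List (Subset (suc n))
    bases = filter (isBasis? M) (allSubsets (suc n))
    min-basis : IsBasis M (min B₀ bases)
    min-basis = argmin-all (λ X → X) B₀-basis (all-filter (isBasis? M) (allSubsets (suc n)))
    min-first : ∀ B → IsBasis M B → LexLeq σ (min B₀ bases) B
    min-first B B-basis = All.lookup (min≤xs B₀ bases) (∈-filter⁺ (isBasis? M) (∈-allSubsets B) B-basis)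

  module _ (i : Fin n) where
    open AdjacentTransposition i

    -- If x ≠ τ p were exchanged instead, (X ─ x) ∪ ⁅ τ q ⁆ would lead X at position q.
    lexFirst-exchange : ∀ (τ : Perm n) {X Y} → IsLexFirstBasis M τ X → IsBasis M Y →
      LeadsAt (word τ X) (word τ Y) p → word τ Y q ≡ true → word τ X q ≡ false →
      IsBasis M ((X ─ (τ ⟨$⟩ʳ p)) ∪ ⁅ τ ⟨$⟩ʳ q ⁆)
    lexFirst-exchange τ {X} {Y} (X-basis , X-first) Y-basis (XY-agree , _ , _) Yq Xq
      with dualBasisExchange X-basis Y-basis Yq Xq
    ... | x , Xx , Yx , D-basis with x FinP.≟ τ ⟨$⟩ʳ p
    ...   | yes refl = D-basis
    ...   | no x≢τp = contradiction (LexLeq⇒≼ τ (X-first D D-basis)) (≺⇒⋡ (q , D-agree , v∈Q , Xq))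
      where
      D = (X ─ x) ∪ ⁅ τ ⟨$⟩ʳ q ⁆
      open Exchanged (exchange-Exchanged {X = X} Xx Xq)
      τj≢x : ∀ {j} → j ≤ p → τ ⟨$⟩ʳ j ≢ x
      τj≢x {j} j≤p with j FinP.≟ p
      ... | yes refl = x≢τp ∘ sym
      ... | no j≢p = λ τj≡x →
        let XY-agree-x = subst (λ z → lookup X z ≡ lookup Y z) τj≡x (XY-agree j (FinP.≤∧≢⇒< j≤p j≢p))
        in BoolP.not-¬ (trans (sym XY-agree-x) Xx) Yx
      D-agree : Agree (word τ D) (word τ X) q
      D-agree j j<q = sym (agree (τ ⟨$⟩ʳ j) (τj≢x (k<q⇒k≤p j<q)) (FinP.<⇒≢ j<q ∘ ⟨$⟩ʳ-injective τ))

    lexFirst-adjacent : ∀ {σ σ′ : Perm n} {B B′} → IsSwapAdj σ σ′ i →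
      IsLexFirstBasis M σ B → IsLexFirstBasis M σ′ B′ →
      lookup B ≗ lookup B′ ⊎ Exchanged (lookup B) (lookup B′) (σ ⟨$⟩ʳ p) (σ ⟨$⟩ʳ q)
    lexFirst-adjacent {σ} {σ′} {B} {B′} swap B-first@(B-basis , B-min) B′-first@(B′-basis , B′-min)
      with ≼-transpose-cases (LexLeq⇒≼ σ (B-min B′ B′-basis))
             (≼-resp (word-swap {σ = σ} {σ′} swap B′) (word-swap {σ = σ} {σ′} swap B)
                     (LexLeq⇒≼ σ′ (B′-min B B-basis)))
    ... | inj₁ B≗B′ = inj₁ λ x → cong (λ Z → lookup Z x) (word-injective σ {B} {B′} B≗B′)
    ... | inj₂ (lead@(_ , Bσp , B′σp) , lead′@(_ , B′σq , Bσq)) =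
      inj₂ (subst (λ Z → Exchanged (lookup B) (lookup Z) (σ ⟨$⟩ʳ p) (σ ⟨$⟩ʳ q))
                  (sym (exchanged-lex-unique i {σ} {σ′} swap {B} {B′} {C} {C′} C-exchanged C′-exchanged
                                             (B-min C′ C′-basis) (B′-min C C-basis)))
                  C-exchanged)
      where
      swapped : ∀ X → word σ′ X ≗ word σ X ∘ t
      swapped = word-swap {σ = σ} {σ′} swap
      at-q : ∀ {h : Fin (suc n) → Bool} {b} → (h ∘ t) p ≡ b → h q ≡ b
      at-q {h} = trans (cong h (sym (transpose-matchˡ p q)))
      σ′-at-q : ∀ X {b} → word σ X p ≡ b → word σ′ X q ≡ b
      σ′-at-q X eq = trans (swapped X q) (trans (cong (word σ X) (transpose-matchʳ p q)) eq)
      lead″ : LeadsAt (word σ′ B′) (word σ′ B) p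
      lead″ = LeadsAt-resp (sym ∘ swapped B′) (sym ∘ swapped B) lead′
      C = (B ─ (σ ⟨$⟩ʳ p)) ∪ ⁅ σ ⟨$⟩ʳ q ⁆
      C′ = (B′ ─ (σ′ ⟨$⟩ʳ p)) ∪ ⁅ σ′ ⟨$⟩ʳ q ⁆
      C-exchanged : Exchanged (lookup B) (lookup C) (σ ⟨$⟩ʳ p) (σ ⟨$⟩ʳ q)
      C-exchanged = exchange-Exchanged {X = B} Bσp (at-q {word σ B} Bσq)
      C′-exchanged : Exchanged (lookup B′) (lookup C′) (σ′ ⟨$⟩ʳ p) (σ′ ⟨$⟩ʳ q)
      C′-exchanged = exchange-Exchanged {X = B′} (trans (swapped B′ p) B′σq) (σ′-at-q B′ B′σp)
      C-basis : IsBasis M C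
      C-basis = lexFirst-exchange σ B-first B′-basis lead (at-q {word σ B′} B′σq) (at-q {word σ B} Bσq)
      C′-basis : IsBasis M C′
      C′-basis = lexFirst-exchange σ′ B′-first B-basis lead″ (σ′-at-q B Bσp) (σ′-at-q B′ B′σp)

proposition3p8 : ∀ (n : ℕ) (M : Matroid n) →
    (∀ (σ : Perm n) → ∃[ B ] IsLexFirstBasis M σ B)
    × (∀ (B : Perm n → Subset (suc n)) → (∀ σ → IsLexFirstBasis M σ (B σ)) →
         InKT (classS B) × InKT (classQ B)
         × (∀ σ → classS B σ +L classQ B σ ≈L classTriv σ))
proposition3p8 n M = lexFirstBasis-exists M , λ B B-first →
    (λ σ σ′ i swap → sumTinv-≡mod (Sum.map₂ inj₁ (adjacent B-first i swap)))
  , (λ σ σ′ i swap →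
       sumTinv-≡mod (Sum.map (λ eq → cong not ∘ eq) (inj₂ ∘ Exchanged-not) (adjacent B-first i swap)))
  , (λ σ → sumTinv-complement (lookup (B σ)))
  where
  adjacent : ∀ {B : Perm n → Subset (suc n)} → (∀ σ → IsLexFirstBasis M σ (B σ)) →
    ∀ {σ σ′} i → IsSwapAdj σ σ′ i →
    lookup (B σ) ≗ lookup (B σ′)
    ⊎ Exchanged (lookup (B σ)) (lookup (B σ′)) (σ ⟨$⟩ʳ inject₁ i) (σ ⟨$⟩ʳ Fin.suc i)
  adjacent B-first {σ} {σ′} i swap = lexFirst-adjacent M i {σ} {σ′} swap (B-first σ) (B-first σ′)
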